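{- Let $n=p_1p_2\cdots p_l$ where $l\leq 15$ and $p_1,\dots,p_l$ are distinct odd primes. Then $n$ is not a $k$-layered number for any $k\geq 3$.
   Context: For a positive integer $k$, a positive integer $n$ is $k$-layered if the set of its positive divisors can be partitioned into $k$ disjoint subsets all having the same sum. -}

module Defs where

open import Data.Nat using (ℕ; suc; _+_; _≤_)
open import Data.Nat.Divisibility using (_∣_; _∣?_)
open import Data.List using (List; filter; map; upTo)
open import Data.Nat.ListAction using (sum)
open import Data.Fin using (Fin; _≟_)
open import Relation.Binary.PropositionalEquality using (_≡_)
open import Relation.Nullary.Decidable using (does)
open import Data.Product using (Σ; _×_)

divisors : ℕ → List ℕ
divisors n = filter (λ d → d ∣? n) (map suc (upTo n))

classSum : {k : ℕ} → (n : ℕ) → (ℕ → Fin k) → Fin k → ℕ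
classSum n c i = sum (filter (λ d → c d ≟ i) (divisors n))

-- A partition into k (labelled) parts is
-- given by a labelling c assigning each divisor to one of the k parts;
-- all k part sums are equal to a common value s.
Layered : ℕ → ℕ → Set
Layered k n = Σ (ℕ → Fin k) λ c → Σ ℕ λ s → (i : Fin k) → classSum n c i ≡ s

module Submission where

-- Proof idea.  Write n = p₁⋯pₗ and σ(n) for the sum of the divisors of n.
--
--  (1) If n is k-layered, every part has the same sum s, and the part
--      containing n itself has sum at least n; since the parts partition the
--      divisors, σ(n) = k·s ≥ k·n.  So k ≥ 3 forces σ(n) ≥ 3n.
--  (2) σ(p·m) = (p + 1)·σ(m) when p is a prime not dividing m: summing the
--      divisor weights over 1 … m·p in blocks of length p, only the last
--      entry e·p of each block differs, and it contributes p·[e ∣ m]·e extra.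
--      Hence σ(p₁⋯pₗ) = (p₁ + 1)⋯(pₗ + 1) for distinct primes.
--  (3) Sorting the primes, the i-th one is at least the i-th odd prime rᵢ,
--      so ∏ (pᵢ + 1)/pᵢ ≤ ∏_{i ≤ 15} (rᵢ + 1)/rᵢ < 3, i.e. σ(n) < 3n.

open import Defs
open import Data.Nat using (ℕ; _≤_; _%_)
open import Data.Nat.Primality using (Prime)
open import Data.List using (List; length)
open import Data.Nat.ListAction using (product)
open import Data.List.Relation.Unary.All using (All)
open import Data.List.Relation.Unary.Unique.Propositional using (Unique)
open import Relation.Binary.PropositionalEquality using (_≡_)
open import Relation.Nullary using (¬_)

open import Data.Nat using (zero; suc; _+_; _*_; _<_; _∸_; s≤s; z<s; NonZero; nonTrivial⇒n>1; _<?_)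
  renaming (_≟_ to _≟ℕ_)
open import Data.Nat.Properties hiding (_≟_)
open import Data.Nat.Divisibility
open import Data.Nat.Primality
  using (prime?; prime⇒irreducible; prime⇒nonZero; prime⇒nonTrivial; productOfPrimes≢0; euclidsLemma; ¬prime[1])
open import Data.Nat.Coprimality using (Coprime; coprime-divisor)
open import Data.Nat.ListAction using (sum)
open import Data.Nat.ListAction.Properties using (sum-++; product-↭)
open import Data.Bool using (Bool; true; false)
open import Data.List using ([]; _∷_; [_]; _++_; filter; map; upTo; applyUpTo)
open import Data.List.Properties using (applyUpTo-∷ʳ; map-upTo; map-applyUpTo)
open import Data.List.Membership.Propositional using (_∈_)
open import Data.List.Membership.Propositional.Properties using (∈-filter⁺; ∈-map⁺; ∈-upTo⁺)
open import Data.List.Relation.Unary.Any using (here; there)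
open import Data.List.Relation.Unary.All using ([]; _∷_)
import Data.List.Relation.Unary.All as All
open import Data.List.Relation.Unary.AllPairs using (AllPairs; []; _∷_)
import Data.List.Relation.Unary.AllPairs as AllPairs
open import Data.List.Relation.Unary.Linked.Properties using (Linked⇒AllPairs)
open import Data.List.Relation.Binary.Permutation.Propositional using (_↭_; ↭-sym; ↭⇒↭ₛ)
open import Data.List.Relation.Binary.Permutation.Propositional.Properties using (All-resp-↭; map⁺; ↭-length)
import Relation.Binary.PropositionalEquality as ≡
open import Relation.Binary.PropositionalEquality
  using (refl; sym; trans; cong; cong₂; subst; _≢_; module ≡-Reasoning)
open import Data.List.Relation.Binary.Permutation.Setoid.Properties (≡.setoid ℕ) using (Unique-resp-↭)
open import Data.List.Sort ≤-decTotalOrder using (sort; sort-↭; sort-↗)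
open import Data.Fin using (Fin; _≟_) renaming (zero to fzero; suc to fsuc)
open import Algebra.Properties.CommutativeMonoid.Sum +-0-commutativeMonoid
  using (sum-syntax; ∑-distrib-+; sum-cong-≗; sum-replicate-zero)
open import Algebra.Properties.CommutativeSemigroup +-commutativeSemigroup
  using () renaming (interchange to +-interchange)
open import Algebra.Properties.CommutativeSemigroup *-commutativeSemigroup
  using () renaming (interchange to *-interchange; xy∙z≈xz∙y to *-right-comm)
open import Data.Product using (_,_)
open import Data.Sum using (inj₁; inj₂)
open import Data.Empty using (⊥-elim)
open import Function using (_∘_; mk⇔)
open import Relation.Unary using (Decidable)
open import Relation.Nullary using (Dec; yes; no; ¬?)
open import Relation.Nullary.Decidable using (does; True; toWitness; dec-false; does-⇔; _→-dec_)

keep : Bool → ℕ → ℕ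
keep true  x = x
keep false _ = 0

keep-* : ∀ b p x → keep b (p * x) ≡ p * keep b x
keep-* true  p x = refl
keep-* false p x = sym (*-zeroʳ p)

sum-filter-∷ : ∀ {P : ℕ → Set} (P? : Decidable P) x xs →
               sum (filter P? (x ∷ xs)) ≡ keep (does (P? x)) x + sum (filter P? xs)
sum-filter-∷ P? x xs with does (P? x)
... | true  = refl
... | false = refl

sum-filter : ∀ {P : ℕ → Set} (P? : Decidable P) xs →
             sum (filter P? xs) ≡ sum (map (λ x → keep (does (P? x)) x) xs)
sum-filter P? []       = refl
sum-filter P? (x ∷ xs) = trans (sum-filter-∷ P? x xs) (cong (_ +_) (sum-filter P? xs))

∈⇒≤sum : ∀ {x xs} → x ∈ xs → x ≤ sum xs
∈⇒≤sum {xs = y ∷ ys} (here refl) = m≤m+n y (sum ys)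
∈⇒≤sum {xs = y ∷ ys} (there x∈) = ≤-trans (∈⇒≤sum x∈) (m≤n+m (sum ys) y)

-- (1) A k-layered number n satisfies k·n ≤ σ(n).

σ : ℕ → ℕ
σ n = sum (divisors n)

∑-keep-δ : ∀ {k} (j : Fin k) x → ∑[ i < k ] keep (does (j ≟ i)) x ≡ x
∑-keep-δ {suc k} fzero    x = trans (cong (x +_) (sum-replicate-zero k)) (+-identityʳ x)
∑-keep-δ {suc k} (fsuc j) x = ∑-keep-δ j x

∑-const : ∀ k s → ∑[ i < k ] s ≡ k * s
∑-const zero    s = refl
∑-const (suc k) s = cong (s +_) (∑-const k s)

sum-by-label : ∀ {k} (c : ℕ → Fin k) xs → sum xs ≡ ∑[ i < k ] sum (filter (λ d → c d ≟ i) xs)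
sum-by-label {k} c []       = sym (sum-replicate-zero k)
sum-by-label {k} c (x ∷ xs) = begin
  x + sum xs
    ≡⟨ cong₂ _+_ (sym (∑-keep-δ (c x) x)) (sum-by-label c xs) ⟩
  ∑[ i < k ] keep (does (c x ≟ i)) x + ∑[ i < k ] sum (filter (λ d → c d ≟ i) xs)
    ≡⟨ sym (∑-distrib-+ (λ i → keep (does (c x ≟ i)) x) (λ i → sum (filter (λ d → c d ≟ i) xs))) ⟩
  ∑[ i < k ] (keep (does (c x ≟ i)) x + sum (filter (λ d → c d ≟ i) xs))
    ≡⟨ sum-cong-≗ (λ i → sym (sum-filter-∷ (λ d → c d ≟ i) x xs)) ⟩
  ∑[ i < k ] sum (filter (λ d → c d ≟ i) (x ∷ xs))
    ∎
  where open ≡-Reasoning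

n≤classSum-self : ∀ {k} m (c : ℕ → Fin k) → suc m ≤ classSum (suc m) c (c (suc m))
n≤classSum-self m c = ∈⇒≤sum (∈-filter⁺ (λ d → c d ≟ c (suc m)) (∈-filter⁺ (_∣? suc m) n∈ ∣-refl) refl)
  where n∈ = ∈-map⁺ suc (∈-upTo⁺ ≤-refl)

-- Every part of a k-layered partition sums to some s ≥ n, and the k parts
-- exhaust the divisors, so k·n ≤ k·s = σ(n).
layered⇒k*n≤σ : ∀ {k} n → Layered k n → k * n ≤ σ n
layered⇒k*n≤σ {k} zero    _           = ≤-reflexive (*-zeroʳ k)
layered⇒k*n≤σ {k} (suc m) (c , s , h) = begin
  k * suc m                       ≤⟨ *-monoʳ-≤ k (subst (suc m ≤_) (h (c (suc m))) (n≤classSum-self m c)) ⟩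
  k * s                           ≡⟨ ∑-const k s ⟨
  ∑[ i < k ] s                    ≡⟨ sum-cong-≗ h ⟨
  ∑[ i < k ] classSum (suc m) c i ≡⟨ sum-by-label c (divisors (suc m)) ⟨
  σ (suc m)                       ∎
  where open ≤-Reasoning

-- (2) σ is multiplicative over a new prime factor.

-- rangeSum f a b = f (a + 1) + … + f (a + b).
rangeSum : (ℕ → ℕ) → ℕ → ℕ → ℕ
rangeSum f a zero    = 0
rangeSum f a (suc b) = rangeSum f a b + f (a + suc b)

sum-applyUpTo : ∀ f N → sum (applyUpTo (f ∘ suc) N) ≡ rangeSum f 0 N
sum-applyUpTo f zero    = refl
sum-applyUpTo f (suc N) = begin
  sum (applyUpTo (f ∘ suc) (suc N))        ≡⟨ cong sum (applyUpTo-∷ʳ (f ∘ suc) N) ⟨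
  sum (applyUpTo (f ∘ suc) N ++ [ f (suc N) ])
    ≡⟨ sum-++ (applyUpTo (f ∘ suc) N) [ f (suc N) ] ⟩
  sum (applyUpTo (f ∘ suc) N) + (f (suc N) + 0)
    ≡⟨ cong₂ _+_ (sum-applyUpTo f N) (+-identityʳ (f (suc N))) ⟩
  rangeSum f 0 (suc N)                     ∎
  where open ≡-Reasoning

rangeSum-cong : ∀ f g a b → (∀ j → j < b → f (a + suc j) ≡ g (a + suc j)) →
                rangeSum f a b ≡ rangeSum g a b
rangeSum-cong f g a zero    eq = refl
rangeSum-cong f g a (suc b) eq =
  cong₂ _+_ (rangeSum-cong f g a b (λ j j<b → eq j (m≤n⇒m≤1+n j<b))) (eq b ≤-refl)

rangeSum-split : ∀ f a b c → rangeSum f a (b + c) ≡ rangeSum f a b + rangeSum f (a + b) c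
rangeSum-split f a b zero    = trans (cong (rangeSum f a) (+-identityʳ b)) (sym (+-identityʳ _))
rangeSum-split f a b (suc c) = begin
  rangeSum f a (b + suc c)                                 ≡⟨ cong (rangeSum f a) (+-suc b c) ⟩
  rangeSum f a (b + c) + f (a + suc (b + c))
    ≡⟨ cong₂ _+_ (rangeSum-split f a b c) (cong f shift) ⟩
  rangeSum f a b + rangeSum f (a + b) c + f (a + b + suc c) ≡⟨ +-assoc (rangeSum f a b) _ _ ⟩
  rangeSum f a b + rangeSum f (a + b) (suc c)              ∎
  where
  open ≡-Reasoning
  shift : a + suc (b + c) ≡ a + b + suc c
  shift = trans (cong (a +_) (sym (+-suc b c))) (sym (+-assoc a b (suc c)))

rangeSum-zero : ∀ f a b → (∀ j → j < b → f (a + suc j) ≡ 0) → rangeSum f a b ≡ 0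
rangeSum-zero f a zero    _    = refl
rangeSum-zero f a (suc b) vanish =
  cong₂ _+_ (rangeSum-zero f a b (λ j j<b → vanish j (m≤n⇒m≤1+n j<b))) (vanish b ≤-refl)

rangeSum-scale : ∀ p f a b → rangeSum (λ d → p * f d) a b ≡ p * rangeSum f a b
rangeSum-scale p f a zero    = sym (*-zeroʳ p)
rangeSum-scale p f a (suc b) =
  trans (cong (_+ p * f (a + suc b)) (rangeSum-scale p f a b))
        (sym (*-distribˡ-+ p (rangeSum f a b) (f (a + suc b))))

rangeSum-blocks : ∀ p .{{_ : NonZero p}} (f g h : ℕ → ℕ) →
                  (∀ d → ¬ p ∣ d → f d ≡ g d) →
                  (∀ e → f (e * p) ≡ g (e * p) + h e) →
                  ∀ N → rangeSum f 0 (N * p) ≡ rangeSum g 0 (N * p) + rangeSum h 0 N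
rangeSum-blocks p f g h off on zero    = refl
rangeSum-blocks p@(suc p′) f g h off on (suc N) = begin
  rangeSum f 0 (p + N * p)                          ≡⟨ cong (rangeSum f 0) (+-comm p (N * p)) ⟩
  rangeSum f 0 (N * p + p)                          ≡⟨ rangeSum-split f 0 (N * p) p ⟩
  rangeSum f 0 (N * p) + rangeSum f (N * p) p
    ≡⟨ cong₂ _+_ (rangeSum-blocks p f g h off on N) block ⟩
  (rangeSum g 0 (N * p) + rangeSum h 0 N) + (rangeSum g (N * p) p + h (suc N))
    ≡⟨ +-interchange (rangeSum g 0 (N * p)) (rangeSum h 0 N) (rangeSum g (N * p) p) (h (suc N)) ⟩
  (rangeSum g 0 (N * p) + rangeSum g (N * p) p) + rangeSum h 0 (suc N)
    ≡⟨ cong (_+ rangeSum h 0 (suc N)) (rangeSum-split g 0 (N * p) p) ⟨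
  rangeSum g 0 (N * p + p) + rangeSum h 0 (suc N)   ≡⟨ cong (λ z → rangeSum g 0 z + rangeSum h 0 (suc N)) (+-comm (N * p) p) ⟩
  rangeSum g 0 (p + N * p) + rangeSum h 0 (suc N)   ∎
  where
  open ≡-Reasoning
  -- the entries N·p + 1 … N·p + p′ of the block are not multiples of p
  inner : ∀ j → j < p′ → f (N * p + suc j) ≡ g (N * p + suc j)
  inner j j<p′ = off _ λ p∣ → <⇒≱ (s≤s j<p′) (∣⇒≤ (∣m+n∣m⇒∣n p∣ (n∣m*n N)))
  last : N * p + p ≡ suc N * p
  last = +-comm (N * p) p
  block : rangeSum f (N * p) p ≡ rangeSum g (N * p) p + h (suc N)
  block = begin
    rangeSum f (N * p) p′ + f (N * p + p)
      ≡⟨ cong₂ _+_ (rangeSum-cong f g (N * p) p′ inner) (trans (cong f last) (on (suc N))) ⟩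
    rangeSum g (N * p) p′ + (g (suc N * p) + h (suc N))
      ≡⟨ cong (λ z → rangeSum g (N * p) p′ + (g z + h (suc N))) last ⟨
    rangeSum g (N * p) p′ + (g (N * p + p) + h (suc N))
      ≡⟨ +-assoc (rangeSum g (N * p) p′) _ _ ⟨
    rangeSum g (N * p) p + h (suc N) ∎

divisorWeight : ℕ → ℕ → ℕ
divisorWeight n d = keep (does (d ∣? n)) d

σ≡rangeSum : ∀ n → σ n ≡ rangeSum (divisorWeight n) 0 n
σ≡rangeSum n = begin
  sum (filter (_∣? n) (map suc (upTo n)))        ≡⟨ sum-filter (_∣? n) (map suc (upTo n)) ⟩
  sum (map (divisorWeight n) (map suc (upTo n))) ≡⟨ cong (sum ∘ map (divisorWeight n)) (map-upTo suc n) ⟩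
  sum (map (divisorWeight n) (applyUpTo suc n))  ≡⟨ cong sum (map-applyUpTo suc (divisorWeight n) n) ⟩
  sum (applyUpTo (divisorWeight n ∘ suc) n)      ≡⟨ sum-applyUpTo (divisorWeight n) n ⟩
  rangeSum (divisorWeight n) 0 n                 ∎
  where open ≡-Reasoning

divisorWeight-∤ : ∀ {n d} → ¬ d ∣ n → divisorWeight n d ≡ 0
divisorWeight-∤ {n} {d} d∤n = cong (λ b → keep b d) (dec-false (d ∣? n) d∤n)

divisorWeight-⇔ : ∀ {n m d} → (d ∣ n → d ∣ m) → (d ∣ m → d ∣ n) → divisorWeight n d ≡ divisorWeight m d
divisorWeight-⇔ {n} {m} {d} to from = cong (λ b → keep b d) (does-⇔ (mk⇔ to from) (d ∣? n) (d ∣? m))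

-- p·e divides p·m exactly when e divides m.
divisorWeight-* : ∀ p .{{_ : NonZero p}} m e → divisorWeight (p * m) (p * e) ≡ p * divisorWeight m e
divisorWeight-* p m e =
  trans (cong (λ b → keep b (p * e)) (does-⇔ (mk⇔ (*-cancelˡ-∣ p) (*-monoʳ-∣ p)) (p * e ∣? p * m) (e ∣? m)))
        (keep-* (does (e ∣? m)) p e)

-- Beyond n no further divisors of n occur, so summing the weights further changes nothing.
rangeSum≡σ : ∀ n .{{_ : NonZero n}} N → n ≤ N → rangeSum (divisorWeight n) 0 N ≡ σ n
rangeSum≡σ n N n≤N = begin
  rangeSum (divisorWeight n) 0 N                 ≡⟨ cong (rangeSum (divisorWeight n) 0) (m+[n∸m]≡n n≤N) ⟨
  rangeSum (divisorWeight n) 0 (n + (N ∸ n))     ≡⟨ rangeSum-split (divisorWeight n) 0 n (N ∸ n) ⟩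
  rangeSum (divisorWeight n) 0 n + rangeSum (divisorWeight n) n (N ∸ n)
    ≡⟨ cong₂ _+_ (sym (σ≡rangeSum n)) (rangeSum-zero (divisorWeight n) n (N ∸ n) beyond) ⟩
  σ n + 0                                        ≡⟨ +-identityʳ (σ n) ⟩
  σ n                                            ∎
  where
  open ≡-Reasoning
  beyond : ∀ j → j < N ∸ n → divisorWeight n (n + suc j) ≡ 0
  beyond j _ = divisorWeight-∤ λ d∣n → <⇒≱ (m<m+n n z<s) (∣⇒≤ d∣n)

-- Everything divides 0, so a number with a non-divisor is non-zero.
∤⇒nonZero : ∀ {d m} → ¬ d ∣ m → NonZero m
∤⇒nonZero {d} {zero}  d∤0 = ⊥-elim (d∤0 (d ∣0))
∤⇒nonZero {d} {suc m} _   = _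

prime∤⇒coprime : ∀ {p d} → Prime p → ¬ p ∣ d → Coprime d p
prime∤⇒coprime pp p∤d (e∣d , e∣p) with prime⇒irreducible pp e∣p
... | inj₁ e≡1 = e≡1
... | inj₂ refl = ⊥-elim (p∤d e∣d)

σ-*-prime : ∀ {p m} → Prime p → ¬ p ∣ m → σ (p * m) ≡ suc p * σ m
σ-*-prime {p} {m} pp p∤m = begin
  σ (p * m)                                         ≡⟨ σ≡rangeSum (p * m) ⟩
  rangeSum (divisorWeight (p * m)) 0 (p * m)        ≡⟨ cong (rangeSum (divisorWeight (p * m)) 0) (*-comm p m) ⟩
  rangeSum (divisorWeight (p * m)) 0 (m * p)
    ≡⟨ rangeSum-blocks p (divisorWeight (p * m)) (divisorWeight m) (λ e → p * divisorWeight m e) off on m ⟩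
  rangeSum (divisorWeight m) 0 (m * p) + rangeSum (λ e → p * divisorWeight m e) 0 m
    ≡⟨ cong₂ _+_ (rangeSum≡σ m (m * p) (m≤m*n m p)) (rangeSum-scale p (divisorWeight m) 0 m) ⟩
  σ m + p * rangeSum (divisorWeight m) 0 m          ≡⟨ cong (λ s → σ m + p * s) (σ≡rangeSum m) ⟨
  suc p * σ m                                       ∎
  where
  open ≡-Reasoning
  instance
    p≢0 : NonZero p
    p≢0 = prime⇒nonZero pp
    m≢0 : NonZero m
    m≢0 = ∤⇒nonZero p∤m
  -- away from multiples of p, divisors of p·m are divisors of m
  off : ∀ d → ¬ p ∣ d → divisorWeight (p * m) d ≡ divisorWeight m d
  off d p∤d = divisorWeight-⇔ (coprime-divisor (prime∤⇒coprime pp p∤d)) (λ d∣m → ∣-trans d∣m (n∣m*n p))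
  -- e·p divides p·m iff e divides m, and e·p never divides m
  on : ∀ e → divisorWeight (p * m) (e * p) ≡ divisorWeight m (e * p) + p * divisorWeight m e
  on e = begin
    divisorWeight (p * m) (e * p)                   ≡⟨ cong (divisorWeight (p * m)) (*-comm e p) ⟩
    divisorWeight (p * m) (p * e)                   ≡⟨ divisorWeight-* p m e ⟩
    p * divisorWeight m e                           ≡⟨ cong (_+ p * divisorWeight m e) ep∤m ⟨
    divisorWeight m (e * p) + p * divisorWeight m e ∎
    where ep∤m = divisorWeight-∤ λ ep∣m → p∤m (∣-trans (n∣m*n e) ep∣m)

prime∤product : ∀ {p} qs → Prime p → All Prime qs → All (p ≢_) qs → ¬ p ∣ product qs
prime∤product []       pp _          _          p∣1 = ¬prime[1] (subst Prime (∣1⇒≡1 p∣1) pp)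
prime∤product (q ∷ qs) pp (pq ∷ pqs) (p≢q ∷ ps≢) p∣qQ with euclidsLemma q (product qs) pp p∣qQ
... | inj₂ p∣Q = prime∤product qs pp pqs ps≢ p∣Q
... | inj₁ p∣q with prime⇒irreducible pq p∣q
...   | inj₁ refl = ¬prime[1] pp
...   | inj₂ p≡q  = p≢q p≡q

σ-product : ∀ ps → All Prime ps → Unique ps → σ (product ps) ≡ product (map suc ps)
σ-product []       _          _          = refl
σ-product (p ∷ ps) (pp ∷ pps) (p∉ ∷ uniq) =
  trans (σ-*-prime pp (prime∤product ps pp pps p∉)) (cong (suc p *_) (σ-product ps pps uniq))

-- (3) For at most 15 distinct odd primes, ∏ (p + 1) < 3·∏ p.

OddPrimeGap : ℕ → ℕ → Set
OddPrimeGap r r′ = ∀ {q} → Prime q → q % 2 ≡ 1 → r < q → r′ ≤ q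

NoOddPrimeBetween : ℕ → ℕ → Set
NoOddPrimeBetween r r′ = ∀ {q} → q < r′ → r < q → q % 2 ≡ 1 → ¬ Prime q

noOddPrimeBetween? : ∀ r r′ → Dec (NoOddPrimeBetween r r′)
noOddPrimeBetween? r r′ = allUpTo? (λ q → (r <? q) →-dec ((q % 2 ≟ℕ 1) →-dec ¬? (prime? q))) r′

oddPrimeGap : ∀ r r′ → True (noOddPrimeBetween? r r′) → OddPrimeGap r r′
oddPrimeGap r r′ ok {q} pq odd r<q with q <? r′
... | yes q<r′ = ⊥-elim (toWitness ok q<r′ r<q odd pq)
... | no  q≮r′ = ≮⇒≥ q≮r′

data OddPrimeLadder : ℕ → List ℕ → Set where
  []  : ∀ {r} → OddPrimeLadder r []
  _∷_ : ∀ {r r′ rs} → OddPrimeGap r r′ → OddPrimeLadder r′ rs → OddPrimeLadder r (r′ ∷ rs)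

first15OddPrimes : List ℕ
first15OddPrimes = 3 ∷ 5 ∷ 7 ∷ 11 ∷ 13 ∷ 17 ∷ 19 ∷ 23 ∷ 29 ∷ 31 ∷ 37 ∷ 41 ∷ 43 ∷ 47 ∷ 53 ∷ []

first15OddPrimes-ladder : OddPrimeLadder 1 first15OddPrimes
first15OddPrimes-ladder =
  oddPrimeGap 1 3 _ ∷ oddPrimeGap 3 5 _ ∷ oddPrimeGap 5 7 _ ∷ oddPrimeGap 7 11 _ ∷
  oddPrimeGap 11 13 _ ∷ oddPrimeGap 13 17 _ ∷ oddPrimeGap 17 19 _ ∷ oddPrimeGap 19 23 _ ∷
  oddPrimeGap 23 29 _ ∷ oddPrimeGap 29 31 _ ∷ oddPrimeGap 31 37 _ ∷ oddPrimeGap 37 41 _ ∷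
  oddPrimeGap 41 43 _ ∷ oddPrimeGap 43 47 _ ∷ oddPrimeGap 47 53 _ ∷ []

first15OddPrimes-abundancy<3 : product (map suc first15OddPrimes) < 3 * product first15OddPrimes
first15OddPrimes-abundancy<3 = toWitness {a? = product (map suc first15OddPrimes) <? 3 * product first15OddPrimes} _

-- x₁/y₁ ≤ x₂/y₂ in cross-multiplied form.
_/_≼_/_ : ℕ → ℕ → ℕ → ℕ → Set
x₁ / y₁ ≼ x₂ / y₂ = x₁ * y₂ ≤ x₂ * y₁

≼-* : ∀ {a b c d e f g h} → a / b ≼ c / d → e / f ≼ g / h → (a * e) / (b * f) ≼ (c * g) / (d * h)
≼-* {a} {b} {c} {d} {e} {f} {g} {h} ab≼cd ef≼gh = begin
  (a * e) * (d * h) ≡⟨ *-interchange a e d h ⟩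
  (a * d) * (e * h) ≤⟨ *-mono-≤ ab≼cd ef≼gh ⟩
  (c * b) * (g * f) ≡⟨ *-interchange c b g f ⟩
  (c * g) * (b * f) ∎
  where open ≤-Reasoning

suc-ratio-antitone : ∀ {r q} → r ≤ q → suc q / q ≼ suc r / r
suc-ratio-antitone {r} {q} r≤q = +-mono-≤ r≤q (≤-reflexive (*-comm q r))

product≤product-suc : ∀ rs → product rs ≤ product (map suc rs)
product≤product-suc []       = ≤-refl
product≤product-suc (r ∷ rs) = *-mono-≤ (n≤1+n r) (product≤product-suc rs)

ladder-bound : ∀ {r rs} → OddPrimeLadder r rs → ∀ qs → All Prime qs → All (λ q → q % 2 ≡ 1) qs →
               AllPairs _<_ qs → All (r <_) qs → length qs ≤ length rs →
               product (map suc qs) / product qs ≼ product (map suc rs) / product rs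
ladder-bound {rs = rs} _ [] _ _ _ _ _ = begin
  1 * product rs       ≡⟨ *-identityˡ (product rs) ⟩
  product rs           ≤⟨ product≤product-suc rs ⟩
  product (map suc rs) ≡⟨ *-identityʳ (product (map suc rs)) ⟨
  product (map suc rs) * 1 ∎
  where open ≤-Reasoning
ladder-bound {rs = r′ ∷ rs} (gap ∷ ladder) (q ∷ qs) (pq ∷ pqs) (oq ∷ oqs) (q<qs ∷ sorted) (r<q ∷ _) (s≤s len) =
  ≼-* {suc q} {q} {suc r′} {r′} {product (map suc qs)} {product qs} {product (map suc rs)} {product rs}
    (suc-ratio-antitone r′≤q) (ladder-bound ladder qs pqs oqs sorted (All.map (≤-<-trans r′≤q) q<qs) len)
  where r′≤q = gap pq oq r<q

-- For at most 15 distinct odd primes pᵢ, ∏ (pᵢ + 1) < 3·∏ pᵢ: sort them and compare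
-- with the ladder of the first 15 odd primes.
abundancy<3 : ∀ ps → length ps ≤ 15 → Unique ps → All Prime ps → All (λ p → p % 2 ≡ 1) ps →
              product (map suc ps) < 3 * product ps
abundancy<3 ps len uniq pr od = *-cancelʳ-< D (product (map suc ps)) (3 * product ps) (begin-strict
  product (map suc ps) * D     ≡⟨ cong (_* D) (product-↭ (map⁺ suc perm)) ⟨
  product (map suc qs) * D     ≤⟨ sorted-bound ⟩
  N * product qs               ≡⟨ cong (N *_) (product-↭ perm) ⟩
  N * product ps               <⟨ *-monoˡ-< (product ps) first15OddPrimes-abundancy<3 ⟩
  3 * D * product ps           ≡⟨ *-right-comm 3 D (product ps) ⟩
  3 * product ps * D           ∎)
  where
  open ≤-Reasoning
  instance
    n≢0 : NonZero (product ps)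
    n≢0 = productOfPrimes≢0 pr
  D = product first15OddPrimes
  N = product (map suc first15OddPrimes)
  qs = sort ps
  perm : qs ↭ ps
  perm = sort-↭ ps
  -- sorted and duplicate-free, hence strictly increasing
  increasing : AllPairs _<_ qs
  increasing = AllPairs.zipWith (λ (le , ne) → ≤∧≢⇒< le ne)
    (Linked⇒AllPairs ≤-trans (sort-↗ ps) , Unique-resp-↭ (↭⇒↭ₛ (↭-sym perm)) uniq)
  primesQ : All Prime qs
  primesQ = All-resp-↭ (↭-sym perm) pr
  sorted-bound : product (map suc qs) * D ≤ N * product qs
  sorted-bound = ladder-bound first15OddPrimes-ladder qs primesQ (All-resp-↭ (↭-sym perm) od) increasing
    (All.map (λ {q} pq → nonTrivial⇒n>1 q {{prime⇒nonTrivial pq}}) primesQ)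
    (≤-trans (≤-reflexive (↭-length perm)) len)

mainTheorem9 : (ps : List ℕ) → length ps ≤ 15 → Unique ps
    → All (λ p → Prime p) ps → All (λ p → p % 2 ≡ 1) ps
    → (k : ℕ) → 3 ≤ k → ¬ Layered k (product ps)
mainTheorem9 ps len uniq pr od k 3≤k layered = <⇒≱ (abundancy<3 ps len uniq pr od) (begin
  3 * product ps             ≤⟨ *-monoˡ-≤ (product ps) 3≤k ⟩
  k * product ps             ≤⟨ layered⇒k*n≤σ (product ps) layered ⟩
  σ (product ps)             ≡⟨ σ-product ps pr uniq ⟩
  product (map suc ps)       ∎)
  where open ≤-Reasoning
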